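{- Let $G$ be a finite simple graph on $n\ge 6$ vertices with $m$ universal vertices, and suppose every other vertex has degree at least $\delta$. If \[ (n-m)\cdot 2^{ -\delta-1}\le\frac{1}{n+2}, \] then $D(G,x)$ is unimodal with mode $\lceil n/2\rceil$, i.e. $d_0(G)\le\cdots\le d_{\lceil n/2\rceil}(G)\ge\cdots\ge d_n(G)$.
   Context: A vertex $v$ is universal if it is adjacent to all other vertices. A set $S\subseteq V(G)$ is dominating if every vertex of $G$ is in $S$ or adjacent to a vertex of $S$; $d_j(G)$ is the number of dominating sets of size $j$ and $D(G,x)=\sum_{j=0}^n d_j(G)x^j$. -}

module Defs where

open import Data.Nat using (ℕ; zero; suc; _+_; _≤_)
open import Data.Bool using (Bool; true; false; _∧_; _∨_; not; if_then_else_)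
open import Data.Fin using (Fin; zero; suc)
open import Data.Fin.Subset using (Subset; _∈_; ∣_∣)
open import Data.Vec using (Vec; []; _∷_; map; _++_)
open import Data.List using (List; []; _∷_; length; filter; allFin)
  renaming (map to mapL; _++_ to _++L_)
open import Relation.Binary.PropositionalEquality using (_≡_; _≢_)
open import Relation.Nullary using (¬_; Dec; yes; no)
open import Relation.Nullary.Decidable using (⌊_⌋; T?)
open import Data.Bool using (T)
open import Data.Fin using (_≟_)
open import Data.Nat.Properties as ℕP using ()

record Graph (n : ℕ) : Set where
  field
    adj   : Fin n → Fin n → Bool
    sym   : ∀ u v → adj u v ≡ adj v u
    irrefl : ∀ v → adj v v ≡ false
open Graph public

countFin : ∀ {n} → (Fin n → Bool) → ℕ
countFin {n} p = length (filter (λ i → T? (p i)) (allFin n))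

degree : ∀ {n} → Graph n → Fin n → ℕ
degree G v = countFin (adj G v)

Universal : ∀ {n} → Graph n → Fin n → Set
Universal G v = ∀ w → w ≢ v → adj G v w ≡ true

isUniversal : ∀ {n} → Graph n → Fin n → Bool
isUniversal {n} G v = allB (allFin n)
  where
  allB : List (Fin n) → Bool
  allB [] = true
  allB (w ∷ ws) = (⌊ w ≟ v ⌋ ∨ adj G v w) ∧ allB ws

numUniversal : ∀ {n} → Graph n → ℕ
numUniversal G = countFin (isUniversal G)

Dominating : ∀ {n} → Graph n → Subset n → Set
Dominating {n} G S = ∀ v → v ∈ S ⊎' (Σ' (Fin n) λ u → u ∈ S × adj G u v ≡ true)
  where
  open import Data.Sum using () renaming (_⊎_ to _⊎'_)
  open import Data.Product using (_×_) renaming (Σ to Σ')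

open import Data.Sum using (_⊎_)
open import Data.Product using (Σ; _×_)
open import Data.Fin.Subset.Properties using (_∈?_)
open import Data.Product.Properties using ()
open import Relation.Nullary.Decidable using (_⊎-dec_; _×-dec_)

allSubsets : ∀ n → List (Subset n)
allSubsets zero = [] ∷ []
allSubsets (suc n) = mapL (true ∷_) (allSubsets n) ++L mapL (false ∷_) (allSubsets n)

anyFin : ∀ {n} {P : Fin n → Set} → (∀ i → Dec (P i)) → Dec (Σ (Fin n) P)
anyFin = Data.Fin.Properties.any? where import Data.Fin.Properties

allFin? : ∀ {n} {P : Fin n → Set} → (∀ i → Dec (P i)) → Dec (∀ i → P i)
allFin? = Data.Fin.Properties.all? where import Data.Fin.Properties

dominating? : ∀ {n} (G : Graph n) (S : Subset n) → Dec (Dominating G S)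
dominating? G S = allFin? (λ v → (v ∈? S) ⊎-dec anyFin (λ u → (u ∈? S) ×-dec (adj G u v Data.Bool.≟ true)))
  where import Data.Bool

d : ∀ {n} → Graph n → ℕ → ℕ
d {n} G j = length (filter (λ S → dominating? G S ×-dec (∣ S ∣ ℕP.≟ j)) (allSubsets n))

UnimodalWithMode : ℕ → (ℕ → ℕ) → ℕ → Set
UnimodalWithMode n a k =
  (∀ i → i + 1 ≤ k → a i ≤ a (i + 1)) ×
  (∀ i → k ≤ i → i + 1 ≤ n → a (i + 1) ≤ a i)

{-# OPTIONS --safe #-}
-- Dominating sets form an up-set of the subset lattice, so the shadow argument gives
-- (n − i)·d_i ≤ (i + 1)·d_{i+1}, hence d_i ≤ d_{i+1} below the middle.  Above the middle (n ≤ 2i)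
-- write d_i = C(n,i) − N_i, with N_i the number of non-dominating i-sets.  For i ≥ 1 such a set
-- misses the closed neighbourhood N[v] of some non-universal vertex v, and |N[v]| ≥ δ + 1, so
-- N_i ≤ (n − m)·C(n − δ − 1, i) ≤ (n − m)·C(n,i)/2^(δ+1) ≤ C(n,i)/(n + 2), using
-- C(a,i)·2^k ≤ C(a + k,i) for a + k ≤ 2i.  Therefore
-- (i + 1)·d_{i+1} ≤ (i + 1)·C(n,i+1) = (n − i)·C(n,i) ≤ i·C(n,i) ≤ (i + 1)·(C(n,i) − N_i) = (i + 1)·d_i.
module Submission where

open import Defs hiding (sym)
open import Data.Bool using (Bool; true; false; T; not; _∧_; _∨_; if_then_else_)
open import Data.Bool.ListAction using (any)
open import Data.Bool.Properties using (∧-zeroʳ; T-∧; T-∨; T-≡; T-not-≡)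
open import Data.Empty using (⊥-elim)
open import Data.Fin using (Fin; zero; suc)
open import Data.Fin.Properties using (¬∀⟶∃¬)
open import Data.Fin.Subset using (Subset; _⊆_; _∈_; _∉_; ⊤; ∣_∣; ⁅_⁆; _∪_; ∁; Nonempty)
open import Data.Fin.Subset.Properties
  using (_⊆?_; _∈?_; ⊆⊤; ⊆-refl; s⊆s; out⊆; p⊆p∪q; q⊆p∪q; p⊂q⇒∣p∣<∣q∣; x∈⁅x⁆; x∈⁅y⁆⇒x≡y;
         x∈p∪q⁻; x∉p⇒x∈∁p; x∈∁p⇒x∉p; ∣⊤∣≡n; ∣∁p∣≡n∸∣p∣; ∣p∣≤n)
open import Data.List using (List; []; _∷_; _++_; map; length; filter; allFin)
open import Data.List.Membership.Propositional using (lose) renaming (_∈_ to _∈ₗ_)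
open import Data.List.Membership.Propositional.Properties using (∈-allFin; ∈-filter⁺)
open import Data.List.Relation.Unary.All using (All; []; _∷_)
open import Data.List.Relation.Unary.All.Properties using (all-filter)
open import Data.List.Relation.Unary.Any using (Any; here; there)
open import Data.List.Relation.Unary.Any.Properties using (any⁺)
open import Data.Nat using (ℕ; zero; suc; _+_; _*_; _∸_; _^_; _≤_; _<_; _≡ᵇ_; z≤n; s≤s; ⌈_/2⌉; ⌊_/2⌋)
open import Data.Nat.Combinatorics using (_C_; nCk+nC[k+1]≡[n+1]C[k+1]; nC1≡n)
open import Data.Nat.ListAction using (sum)
open import Data.Nat.Properties
open import Data.Nat.Solver using (module +-*-Solver)
open import Data.Product using (_×_; _,_; proj₁; proj₂; map₁; ∃-syntax)
open import Data.Sum using (_⊎_; inj₁; inj₂)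
open import Data.Vec using ([]; _∷_)
open import Data.Vec.Properties using (lookup∘tabulate; []=⇒lookup; lookup⇒[]=; tabulate-∘)
open import Function using (_∘_; id; _⇔_; Equivalence; mk⇔)
open import Relation.Binary.PropositionalEquality
open import Relation.Nullary using (¬_; Dec; yes; no; does; contradiction)
open import Relation.Nullary.Decidable using (⌊_⌋; T?; ¬?; dec-true; toWitness; _×-dec_; _⊎-dec_)
open import Relation.Unary using (Pred; Decidable)
import Data.Bool as Bool
import Data.Fin as Fin
import Data.List as List
import Data.List.Relation.Unary.All as All
import Data.Product as Product
import Data.Sum as Sum
import Data.Vec as Vec

open +-*-Solver using (solve; _:+_; _:*_; _:=_; con)

private
  variable
    A B : Set
    n : ℕ

-- Counting

count : (A → Bool) → List A → ℕ
count p []       = 0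
count p (x ∷ xs) = if p x then suc (count p xs) else count p xs

length-filter≡count : ∀ {ℓ} {P : Pred A ℓ} (P? : Decidable P) xs → length (filter P? xs) ≡ count (does ∘ P?) xs
length-filter≡count P? []       = refl
length-filter≡count P? (x ∷ xs) with does (P? x)
... | true  = cong suc (length-filter≡count P? xs)
... | false = length-filter≡count P? xs

module _ (p : A → Bool) where

  count-++ : ∀ xs ys → count p (xs ++ ys) ≡ count p xs + count p ys
  count-++ []       ys = refl
  count-++ (x ∷ xs) ys with p x
  ... | true  = cong suc (count-++ xs ys)
  ... | false = count-++ xs ys

  count-map : ∀ (f : B → A) xs → count p (map f xs) ≡ count (p ∘ f) xs
  count-map f []       = refl
  count-map f (x ∷ xs) with p (f x)
  ... | true  = cong suc (count-map f xs)
  ... | false = count-map f xs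

count-false : ∀ (xs : List A) → count (λ _ → false) xs ≡ 0
count-false []       = refl
count-false (x ∷ xs) = count-false xs

count-cong : ∀ {p q : A → Bool} → (∀ x → p x ≡ q x) → ∀ xs → count p xs ≡ count q xs
count-cong         p≗q []       = refl
count-cong {q = q} p≗q (x ∷ xs) rewrite p≗q x with q x
... | true  = cong suc (count-cong p≗q xs)
... | false = count-cong p≗q xs

count-mono : ∀ {p q : A → Bool} → (∀ x → T (p x) → T (q x)) → ∀ xs → count p xs ≤ count q xs
count-mono         p⇒q []       = z≤n
count-mono {p = p} {q} p⇒q (x ∷ xs) with p x | q x | p⇒q x
... | true  | true  | _    = s≤s (count-mono p⇒q xs)
... | true  | false | px⇒⊥ = ⊥-elim (px⇒⊥ _)
... | false | true  | _    = m≤n⇒m≤1+n (count-mono p⇒q xs)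
... | false | false | _    = count-mono p⇒q xs

module _ (p q : A → Bool) where

  count-∧-not : ∀ xs → count (λ x → p x ∧ q x) xs + count (λ x → not (p x) ∧ q x) xs ≡ count q xs
  count-∧-not []       = refl
  count-∧-not (x ∷ xs) with p x | q x
  ... | true  | true  = cong suc (count-∧-not xs)
  ... | false | true  = trans (+-suc _ _) (cong suc (count-∧-not xs))
  ... | true  | false = count-∧-not xs
  ... | false | false = count-∧-not xs

  count-∨ : ∀ xs → count (λ x → p x ∨ q x) xs ≤ count p xs + count q xs
  count-∨ []       = z≤n
  count-∨ (x ∷ xs) with p x | q x
  ... | true  | true  = s≤s (≤-trans (count-∨ xs) (+-monoʳ-≤ (count p xs) (n≤1+n _)))
  ... | true  | false = s≤s (count-∨ xs)
  ... | false | true  = ≤-trans (s≤s (count-∨ xs)) (≤-reflexive (sym (+-suc _ _)))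
  ... | false | false = count-∨ xs

count-any≤sum : ∀ (q : B → A → Bool) vs xs →
  count (λ x → any (λ v → q v x) vs) xs ≤ sum (map (λ v → count (q v) xs) vs)
count-any≤sum q []       xs = ≤-reflexive (count-false xs)
count-any≤sum q (v ∷ vs) xs = ≤-trans (count-∨ (q v) _ xs) (+-monoʳ-≤ _ (count-any≤sum q vs xs))

count-union-bound : ∀ {p : A → Bool} (q : B → A → Bool) vs xs →
  (∀ x → T (p x) → Any (λ v → T (q v x)) vs) →
  count p xs ≤ sum (map (λ v → count (q v) xs) vs)
count-union-bound q vs xs cover =
  ≤-trans (count-mono (λ x px → any⁺ (λ v → q v x) (cover x px)) xs) (count-any≤sum q vs xs)

sum-map-*-≤ : ∀ (f : A → ℕ) {k c} vs → All (λ v → f v * k ≤ c) vs → sum (map f vs) * k ≤ length vs * c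
sum-map-*-≤ f         []       []          = z≤n
sum-map-*-≤ f {k} {c} (v ∷ vs) (fv≤ ∷ fvs≤) =
  ≤-trans (≤-reflexive (*-distribʳ-+ k (f v) _)) (+-mono-≤ fv≤ (sum-map-*-≤ f vs fvs≤))

T-does : ∀ {ℓ} {P : Set ℓ} (P? : Dec P) → T (does P?) ⇔ P
T-does (yes p) = mk⇔ (λ _ → p) (λ _ → _)
T-does (no ¬p) = mk⇔ (λ ()) ¬p

count-allSubsets-suc : ∀ (p : Subset (suc n) → Bool) →
  count p (allSubsets (suc n)) ≡ count (p ∘ (true ∷_)) (allSubsets n) + count (p ∘ (false ∷_)) (allSubsets n)
count-allSubsets-suc {n} p = trans (count-++ p (map (true ∷_) (allSubsets n)) _)
  (cong₂ _+_ (count-map p (true ∷_) (allSubsets n)) (count-map p (false ∷_) (allSubsets n)))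

countOfSize : (Subset n → Bool) → ℕ → ℕ
countOfSize {n} p i = count (λ S → p S ∧ (∣ S ∣ ≡ᵇ i)) (allSubsets n)

countOfSize-zero : ∀ (p : Subset (suc n) → Bool) → countOfSize p 0 ≡ countOfSize (p ∘ (false ∷_)) 0
countOfSize-zero {n} p = trans (count-allSubsets-suc {n} (λ S → p S ∧ (∣ S ∣ ≡ᵇ 0)))
  (cong (_+ countOfSize (p ∘ (false ∷_)) 0)
        (trans (count-cong (λ S → ∧-zeroʳ (p (true ∷ S))) (allSubsets n)) (count-false (allSubsets n))))

countOfSize-suc : ∀ (p : Subset (suc n) → Bool) i →
  countOfSize p (suc i) ≡ countOfSize (p ∘ (true ∷_)) i + countOfSize (p ∘ (false ∷_)) (suc i)
countOfSize-suc {n} p i = count-allSubsets-suc {n} (λ S → p S ∧ (∣ S ∣ ≡ᵇ suc i))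

countOfSize-mono : ∀ {p q : Subset n → Bool} → (∀ S → T (p S) → T (q S)) → ∀ i →
  countOfSize p i ≤ countOfSize q i
countOfSize-mono {n} p⇒q i =
  count-mono (λ S → Equivalence.from T-∧ ∘ map₁ (p⇒q S) ∘ Equivalence.to T-∧) (allSubsets n)

countOfSize-⊆ : ∀ (R : Subset n) i → countOfSize (λ S → does (S ⊆? R)) i ≡ ∣ R ∣ C i
countOfSize-⊆ []          zero    = refl
countOfSize-⊆ []          (suc i) = refl
countOfSize-⊆ (true ∷ R)  zero    = trans (countOfSize-zero (λ S → does (S ⊆? true ∷ R))) (countOfSize-⊆ R 0)
countOfSize-⊆ (true ∷ R)  (suc i) = begin
  countOfSize (λ S → does (S ⊆? true ∷ R)) (suc i)  ≡⟨ countOfSize-suc (λ S → does (S ⊆? true ∷ R)) i ⟩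
  countOfSize (λ S → does (S ⊆? R)) i
    + countOfSize (λ S → does (S ⊆? R)) (suc i)     ≡⟨ cong₂ _+_ (countOfSize-⊆ R i) (countOfSize-⊆ R (suc i)) ⟩
  ∣ R ∣ C i + ∣ R ∣ C suc i                          ≡⟨ nCk+nC[k+1]≡[n+1]C[k+1] ∣ R ∣ i ⟩
  suc ∣ R ∣ C suc i                                  ∎
  where open ≡-Reasoning
countOfSize-⊆ {suc n} (false ∷ R) i =
  trans (count-allSubsets-suc (λ S → does (S ⊆? false ∷ R) ∧ (∣ S ∣ ≡ᵇ i)))
        (cong₂ _+_ (count-false (allSubsets n)) (countOfSize-⊆ R i))

countOfSize-true : ∀ i → countOfSize {n} (λ _ → true) i ≡ n C i
countOfSize-true {n} i = begin
  countOfSize {n} (λ _ → true) i           ≡⟨ count-cong (λ S → cong (_∧ (∣ S ∣ ≡ᵇ i)) (sym (dec-true (S ⊆? ⊤) ⊆⊤)))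
                                                         (allSubsets n) ⟩
  countOfSize (λ S → does (S ⊆? ⊤ {n})) i  ≡⟨ countOfSize-⊆ (⊤ {n}) i ⟩
  ∣ ⊤ {n} ∣ C i                            ≡⟨ cong (_C i) (∣⊤∣≡n n) ⟩
  n C i                                    ∎
  where open ≡-Reasoning

countOfSize-not : ∀ (p : Subset n → Bool) i → countOfSize p i + countOfSize (not ∘ p) i ≡ n C i
countOfSize-not {n} p i = trans (count-∧-not p (λ S → ∣ S ∣ ≡ᵇ i) (allSubsets n)) (countOfSize-true i)

∣p∣≡suc⇒nonempty : ∀ (S : Subset n) {i} → ∣ S ∣ ≡ suc i → Nonempty S
∣p∣≡suc⇒nonempty (true  ∷ S) _    = zero , Vec.here
∣p∣≡suc⇒nonempty (false ∷ S) size = Product.map suc Vec.there (∣p∣≡suc⇒nonempty S size)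

-- Binomial coefficients

[1+k]*nC[1+k]+k*nCk≡n*nCk : ∀ n k → suc k * (n C suc k) + k * (n C k) ≡ n * (n C k)
[1+k]*nC[1+k]+k*nCk≡n*nCk zero    zero    = refl
[1+k]*nC[1+k]+k*nCk≡n*nCk zero    (suc k) = cong₂ _+_ (*-zeroʳ (suc (suc k))) (*-zeroʳ (suc k))
[1+k]*nC[1+k]+k*nCk≡n*nCk (suc n) zero    = begin
  1 * (suc n C 1) + 0   ≡⟨ trans (+-identityʳ _) (*-identityˡ _) ⟩
  suc n C 1             ≡⟨ nC1≡n (suc n) ⟩
  suc n                 ≡⟨ *-identityʳ (suc n) ⟨
  suc n * 1             ∎
  where open ≡-Reasoning
[1+k]*nC[1+k]+k*nCk≡n*nCk (suc n) (suc k) = begin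
  suc (suc k) * (suc n C suc (suc k)) + suc k * (suc n C suc k)
    ≡⟨ cong₂ (λ x y → suc (suc k) * x + suc k * y) (pascal (suc k)) (pascal k) ⟨
  suc (suc k) * (b + c) + suc k * (a + b)
    ≡⟨ regroup k a b c ⟩
  (suc (suc k) * c + suc k * b) + (suc k * b + k * a) + (a + b)
    ≡⟨ cong₂ (λ x y → x + y + (a + b)) ([1+k]*nC[1+k]+k*nCk≡n*nCk n (suc k)) ([1+k]*nC[1+k]+k*nCk≡n*nCk n k) ⟩
  n * b + n * a + (a + b)
    ≡⟨ collect n a b ⟩
  suc n * (a + b)
    ≡⟨ cong (suc n *_) (pascal k) ⟩
  suc n * (suc n C suc k)
    ∎
  where
  open ≡-Reasoning
  a = n C k
  b = n C suc k
  c = n C suc (suc k)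
  pascal : ∀ k → n C k + n C suc k ≡ suc n C suc k
  pascal = nCk+nC[k+1]≡[n+1]C[k+1] n
  regroup : ∀ k a b c →
    suc (suc k) * (b + c) + suc k * (a + b) ≡ (suc (suc k) * c + suc k * b) + (suc k * b + k * a) + (a + b)
  regroup = solve 4 (λ k a b c → (con 2 :+ k) :* (b :+ c) :+ (con 1 :+ k) :* (a :+ b)
                     := ((con 2 :+ k) :* c :+ (con 1 :+ k) :* b) :+ ((con 1 :+ k) :* b :+ k :* a) :+ (a :+ b)) refl
  collect : ∀ n a b → n * b + n * a + (a + b) ≡ suc n * (a + b)
  collect = solve 3 (λ n a b → n :* b :+ n :* a :+ (a :+ b) := (con 1 :+ n) :* (a :+ b)) refl

n≤k+r⇒[1+k]*nC[1+k]≤r*nCk : ∀ {n k r} → n ≤ k + r → suc k * (n C suc k) ≤ r * (n C k)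
n≤k+r⇒[1+k]*nC[1+k]≤r*nCk {n} {k} {r} n≤k+r = +-cancelʳ-≤ (k * (n C k)) _ _ (begin
  suc k * (n C suc k) + k * (n C k)   ≡⟨ [1+k]*nC[1+k]+k*nCk≡n*nCk n k ⟩
  n * (n C k)                         ≤⟨ *-monoˡ-≤ (n C k) n≤k+r ⟩
  (k + r) * (n C k)                   ≡⟨ *-distribʳ-+ (n C k) k r ⟩
  k * (n C k) + r * (n C k)           ≡⟨ +-comm (k * (n C k)) _ ⟩
  r * (n C k) + k * (n C k)           ∎)
  where open ≤-Reasoning

n≤2k+1⇒2*nC[1+k]≤[1+n]C[1+k] : ∀ {n k} → n ≤ k + suc k → 2 * (n C suc k) ≤ suc n C suc k
n≤2k+1⇒2*nC[1+k]≤[1+n]C[1+k] {n} {k} n≤2k+1 = begin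
  2 * (n C suc k)          ≡⟨ cong (n C suc k +_) (+-identityʳ _) ⟩
  n C suc k + n C suc k    ≤⟨ +-monoˡ-≤ (n C suc k) (*-cancelˡ-≤ (suc k) (n≤k+r⇒[1+k]*nC[1+k]≤r*nCk n≤2k+1)) ⟩
  n C k + n C suc k        ≡⟨ nCk+nC[k+1]≡[n+1]C[k+1] n k ⟩
  suc n C suc k            ∎
  where open ≤-Reasoning

a+k≤2i⇒aCi*2^k≤[a+k]Ci : ∀ a k i → a + k ≤ i + i → (a C i) * 2 ^ k ≤ (a + k) C i
a+k≤2i⇒aCi*2^k≤[a+k]Ci a zero    i       _ =
  ≤-reflexive (trans (*-identityʳ (a C i)) (cong (_C i) (sym (+-identityʳ a))))
a+k≤2i⇒aCi*2^k≤[a+k]Ci a (suc k) zero    a+k+1≤0 =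
  contradiction (trans (sym (n≤0⇒n≡0 a+k+1≤0)) (+-suc a k)) λ ()
a+k≤2i⇒aCi*2^k≤[a+k]Ci a (suc k) (suc j) a+k+1≤2j+2 = begin
  (a C suc j) * (2 * 2 ^ k)   ≡⟨ x*[2*y]≡2*[x*y] (a C suc j) (2 ^ k) ⟩
  2 * ((a C suc j) * 2 ^ k)   ≤⟨ *-monoʳ-≤ 2 (a+k≤2i⇒aCi*2^k≤[a+k]Ci a k (suc j)
                                               (≤-trans (+-monoʳ-≤ a (n≤1+n k)) a+k+1≤2j+2)) ⟩
  2 * ((a + k) C suc j)       ≤⟨ n≤2k+1⇒2*nC[1+k]≤[1+n]C[1+k] a+k≤2j+1 ⟩
  suc (a + k) C suc j         ≡⟨ cong (_C suc j) (+-suc a k) ⟨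
  (a + suc k) C suc j         ∎
  where
  open ≤-Reasoning
  a+k≤2j+1 : a + k ≤ j + suc j
  a+k≤2j+1 = ≤-pred (subst (_≤ suc j + suc j) (+-suc a k) a+k+1≤2j+2)
  x*[2*y]≡2*[x*y] : ∀ x y → x * (2 * y) ≡ 2 * (x * y)
  x*[2*y]≡2*[x*y] = solve 2 (λ x y → x :* (con 2 :* y) := con 2 :* (x :* y)) refl

countOfSize-⊆∁*2^∣R∣≤nCi : ∀ (R : Subset n) i → n ≤ i + i →
  countOfSize (λ S → does (S ⊆? ∁ R)) i * 2 ^ ∣ R ∣ ≤ n C i
countOfSize-⊆∁*2^∣R∣≤nCi {n} R i n≤2i = begin
  countOfSize (λ S → does (S ⊆? ∁ R)) i * 2 ^ ∣ R ∣
    ≡⟨ cong (_* 2 ^ ∣ R ∣) (trans (countOfSize-⊆ (∁ R) i) (cong (_C i) (∣∁p∣≡n∸∣p∣ R))) ⟩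
  ((n ∸ ∣ R ∣) C i) * 2 ^ ∣ R ∣
    ≤⟨ a+k≤2i⇒aCi*2^k≤[a+k]Ci (n ∸ ∣ R ∣) ∣ R ∣ i (≤-trans (≤-reflexive n∸r+r≡n) n≤2i) ⟩
  (n ∸ ∣ R ∣ + ∣ R ∣) C i
    ≡⟨ cong (_C i) n∸r+r≡n ⟩
  n C i
    ∎
  where
  open ≤-Reasoning
  n∸r+r≡n : n ∸ ∣ R ∣ + ∣ R ∣ ≡ n
  n∸r+r≡n = m∸n+n≡m (∣p∣≤n R)

-- Up-sets

UpwardClosed : (Subset n → Bool) → Set
UpwardClosed p = ∀ {R S} → R ⊆ S → T (p R) → T (p S)

m∸n≤1+m∸[1+n] : ∀ m n → m ∸ n ≤ suc (m ∸ suc n)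
m∸n≤1+m∸[1+n] zero    n       = ≤-trans (≤-reflexive (0∸n≡0 n)) z≤n
m∸n≤1+m∸[1+n] (suc m) zero    = ≤-refl
m∸n≤1+m∸[1+n] (suc m) (suc n) = m∸n≤1+m∸[1+n] m n

upwardClosed-outside≤inside : ∀ {p : Subset (suc n) → Bool} → UpwardClosed p → ∀ i →
  countOfSize (p ∘ (false ∷_)) i ≤ countOfSize (p ∘ (true ∷_)) i
upwardClosed-outside≤inside {n} up = countOfSize-mono {n} (λ S → up (out⊆ ⊆-refl))

upwardClosed-countOfSize-ratio : ∀ {p : Subset n → Bool} → UpwardClosed p → ∀ i →
  (n ∸ i) * countOfSize p i ≤ suc i * countOfSize p (suc i)
upwardClosed-countOfSize-ratio {zero}          up i rewrite 0∸n≡0 i = z≤n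
upwardClosed-countOfSize-ratio {suc n} {p = p} up = step
  where
  open ≤-Reasoning
  a b : ℕ → ℕ
  a = countOfSize (p ∘ (false ∷_))
  b = countOfSize (p ∘ (true ∷_))
  a≤b : ∀ i → a i ≤ b i
  a≤b = upwardClosed-outside≤inside up
  ih : ∀ {c} i → (n ∸ i) * countOfSize (p ∘ (c ∷_)) i ≤ suc i * countOfSize (p ∘ (c ∷_)) (suc i)
  ih = upwardClosed-countOfSize-ratio (up ∘ s⊆s)
  regroup : ∀ j x y → suc j * x + (x + suc (suc j) * y) ≡ suc (suc j) * (x + y)
  regroup = solve 3 (λ j x y → (con 1 :+ j) :* x :+ (x :+ (con 2 :+ j) :* y) := (con 2 :+ j) :* (x :+ y)) refl
  step : ∀ i → (suc n ∸ i) * countOfSize p i ≤ suc i * countOfSize p (suc i)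
  step zero = begin
    suc n * countOfSize p 0   ≡⟨ cong (suc n *_) (countOfSize-zero p) ⟩
    a 0 + n * a 0             ≤⟨ +-mono-≤ (a≤b 0) (ih 0) ⟩
    b 0 + 1 * a 1             ≡⟨ cong (b 0 +_) (*-identityˡ (a 1)) ⟩
    b 0 + a 1                 ≡⟨ countOfSize-suc p 0 ⟨
    countOfSize p 1           ≡⟨ *-identityˡ _ ⟨
    1 * countOfSize p 1       ∎
  step (suc j) = begin
    (n ∸ j) * countOfSize p (suc j)
      ≡⟨ cong ((n ∸ j) *_) (countOfSize-suc p j) ⟩
    (n ∸ j) * (b j + a (suc j))
      ≡⟨ *-distribˡ-+ (n ∸ j) (b j) _ ⟩
    (n ∸ j) * b j + (n ∸ j) * a (suc j)
      ≤⟨ +-mono-≤ (ih j) (*-monoˡ-≤ (a (suc j)) (m∸n≤1+m∸[1+n] n j)) ⟩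
    suc j * b (suc j) + (a (suc j) + (n ∸ suc j) * a (suc j))
      ≤⟨ +-monoʳ-≤ (suc j * b (suc j)) (+-mono-≤ (a≤b (suc j)) (ih (suc j))) ⟩
    suc j * b (suc j) + (b (suc j) + suc (suc j) * a (suc (suc j)))
      ≡⟨ regroup j (b (suc j)) (a (suc (suc j))) ⟩
    suc (suc j) * (b (suc j) + a (suc (suc j)))
      ≡⟨ cong (suc (suc j) *_) (countOfSize-suc p (suc j)) ⟨
    suc (suc j) * countOfSize p (suc (suc j))
      ∎

upwardClosed-countOfSize-increasing : ∀ {p : Subset n → Bool} → UpwardClosed p → ∀ i → i + i < n →
  countOfSize p i ≤ countOfSize p (suc i)
upwardClosed-countOfSize-increasing {n} {p} up i 2i<n = *-cancelˡ-≤ (suc i) (begin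
  suc i * countOfSize p i         ≤⟨ *-monoˡ-≤ (countOfSize p i) (m+n≤o⇒m≤o∸n (suc i) 2i<n) ⟩
  (n ∸ i) * countOfSize p i       ≤⟨ upwardClosed-countOfSize-ratio up i ⟩
  suc i * countOfSize p (suc i)   ∎)
  where open ≤-Reasoning

-- Dominating sets

dominates : Graph n → Subset n → Bool
dominates G S = does (dominating? G S)

d≡countOfSize : ∀ (G : Graph n) i → d G i ≡ countOfSize (dominates G) i
d≡countOfSize {n} G i = length-filter≡count (λ S → dominating? G S ×-dec (∣ S ∣ ≟ i)) (allSubsets n)

dominating-⊆ : ∀ (G : Graph n) {R S} → R ⊆ S → Dominating G R → Dominating G S
dominating-⊆ G R⊆S dom v = Sum.map R⊆S (Product.map₂ (Product.map₁ R⊆S)) (dom v)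

dominates-upwardClosed : ∀ (G : Graph n) → UpwardClosed (dominates G)
dominates-upwardClosed G {R} {S} R⊆S =
  Equivalence.from (T-does (dominating? G S)) ∘ dominating-⊆ G R⊆S ∘ Equivalence.to (T-does (dominating? G R))

dominating-increasing : ∀ (G : Graph n) i → i + i < n → d G i ≤ d G (suc i)
dominating-increasing G i 2i<n = subst₂ _≤_ (sym (d≡countOfSize G i)) (sym (d≡countOfSize G (suc i)))
  (upwardClosed-countOfSize-increasing (dominates-upwardClosed G) i 2i<n)

∈-tabulate⁻ : ∀ {p : Fin n → Bool} {x} → x ∈ Vec.tabulate p → p x ≡ true
∈-tabulate⁻ {p = p} {x} x∈ = trans (sym (lookup∘tabulate p x)) ([]=⇒lookup x∈)

∈-tabulate⁺ : ∀ {p : Fin n → Bool} {x} → p x ≡ true → x ∈ Vec.tabulate p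
∈-tabulate⁺ {p = p} {x} px = lookup⇒[]= x (Vec.tabulate p) (trans (lookup∘tabulate p x) px)

length-filter-tabulate : ∀ (p : A → Bool) (g : Fin n → A) →
  length (filter (T? ∘ p) (List.tabulate g)) ≡ ∣ Vec.tabulate (p ∘ g) ∣
length-filter-tabulate {n = zero}  p g = refl
length-filter-tabulate {n = suc n} p g with p (g zero)
... | true  = cong suc (length-filter-tabulate p (g ∘ suc))
... | false = length-filter-tabulate p (g ∘ suc)

countFin≡∣tabulate∣ : ∀ (p : Fin n → Bool) → countFin p ≡ ∣ Vec.tabulate p ∣
countFin≡∣tabulate∣ p = length-filter-tabulate p id

closedNeighbourhood : Graph n → Fin n → Subset n
closedNeighbourhood G v = ⁅ v ⁆ ∪ Vec.tabulate (adj G v)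

degree<∣closedNeighbourhood∣ : ∀ (G : Graph n) v → degree G v < ∣ closedNeighbourhood G v ∣
degree<∣closedNeighbourhood∣ G v = subst (_< ∣ closedNeighbourhood G v ∣) (sym (countFin≡∣tabulate∣ (adj G v)))
  (p⊂q⇒∣p∣<∣q∣ (q⊆p∪q ⁅ v ⁆ _ , v , p⊆p∪q _ (x∈⁅x⁆ v) , v∉Γv))
  where
  v∉Γv : v ∉ Vec.tabulate (adj G v)
  v∉Γv v∈Γv with () ← trans (sym (irrefl G v)) (∈-tabulate⁻ v∈Γv)

undominated⇒⊆∁closedNeighbourhood : ∀ (G : Graph n) {S v} →
  ¬ (v ∈ S ⊎ ∃[ u ] u ∈ S × adj G u v ≡ true) → S ⊆ ∁ (closedNeighbourhood G v)
undominated⇒⊆∁closedNeighbourhood G {S} {v} undominated {u} u∈S = x∉p⇒x∈∁p u∉N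
  where
  u∉N : u ∉ closedNeighbourhood G v
  u∉N u∈N with x∈p∪q⁻ ⁅ v ⁆ _ u∈N
  ... | inj₁ u∈⁅v⁆ = undominated (inj₁ (subst (_∈ S) (x∈⁅y⁆⇒x≡y v u∈⁅v⁆) u∈S))
  ... | inj₂ u∈Γv  = undominated (inj₂ (u , u∈S , trans (Graph.sym G u v) (∈-tabulate⁻ u∈Γv)))

¬dominating⇒⊆∁closedNeighbourhood : ∀ (G : Graph n) {S} → ¬ Dominating G S →
  ∃[ v ] S ⊆ ∁ (closedNeighbourhood G v)
¬dominating⇒⊆∁closedNeighbourhood {n} G {S} ¬dom =
  Product.map₂ (undominated⇒⊆∁closedNeighbourhood G) (¬∀⟶∃¬ n _ dominated? ¬dom)
  where
  dominated? : ∀ v → Dec (v ∈ S ⊎ ∃[ u ] u ∈ S × adj G u v ≡ true)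
  dominated? v = (v ∈? S) ⊎-dec anyFin (λ u → (u ∈? S) ×-dec (adj G u v Bool.≟ true))

-- `isUniversal` folds a helper local to its definition over `allFin n`; unification names that helper here.
private
  mutual
    adjacentToAll : Graph n → Fin n → List (Fin n) → Bool
    adjacentToAll G v = _

    isUniversal≡adjacentToAll : ∀ (G : Graph n) v → isUniversal G v ≡ adjacentToAll G v (allFin n)
    isUniversal≡adjacentToAll {n} G v with allFin n
    ... | _ = refl

adjacentToAll-sound : ∀ (G : Graph n) {v w ws} → w ≢ v → w ∈ₗ ws → T (adjacentToAll G v ws) → T (adj G v w)
adjacentToAll-sound G {v} {w} w≢v (here refl) all
  with Equivalence.to (T-∨ {⌊ w Fin.≟ v ⌋}) (proj₁ (Equivalence.to T-∧ all))
... | inj₁ w≡v = contradiction (toWitness {a? = w Fin.≟ v} w≡v) w≢v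
... | inj₂ vw  = vw
adjacentToAll-sound G w≢v (there w∈ws) all = adjacentToAll-sound G w≢v w∈ws (proj₂ (Equivalence.to T-∧ all))

isUniversal-sound : ∀ (G : Graph n) {v} → isUniversal G v ≡ true → Universal G v
isUniversal-sound {n} G {v} universal w w≢v = Equivalence.to T-≡ (adjacentToAll-sound G w≢v (∈-allFin w)
  (Equivalence.from T-≡ (trans (sym (isUniversal≡adjacentToAll G v)) universal)))

nonempty-⊆∁closedNeighbourhood⇒¬universal : ∀ (G : Graph n) {S v} → Nonempty S →
  S ⊆ ∁ (closedNeighbourhood G v) → isUniversal G v ≡ false
nonempty-⊆∁closedNeighbourhood⇒¬universal G {S} {v} (u , u∈S) S⊆∁N with isUniversal G v in universal
... | false = refl
... | true  = contradiction (q⊆p∪q ⁅ v ⁆ _ (∈-tabulate⁺ (isUniversal-sound G universal u u≢v)))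
                            (x∈∁p⇒x∉p (S⊆∁N u∈S))
  where
  u≢v : u ≢ v
  u≢v refl = x∈∁p⇒x∉p (S⊆∁N u∈S) (p⊆p∪q _ (x∈⁅x⁆ v))

nonUniversal : Graph n → List (Fin n)
nonUniversal {n} G = filter (λ v → T? (not (isUniversal G v))) (allFin n)

length-nonUniversal : ∀ (G : Graph n) → length (nonUniversal G) ≡ n ∸ numUniversal G
length-nonUniversal {n} G = begin
  length (nonUniversal G)                  ≡⟨ countFin≡∣tabulate∣ (not ∘ isUniversal G) ⟩
  ∣ Vec.tabulate (not ∘ isUniversal G) ∣   ≡⟨ cong ∣_∣ (tabulate-∘ not (isUniversal G)) ⟩
  ∣ ∁ (Vec.tabulate (isUniversal G)) ∣     ≡⟨ ∣∁p∣≡n∸∣p∣ (Vec.tabulate (isUniversal G)) ⟩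
  n ∸ ∣ Vec.tabulate (isUniversal G) ∣     ≡⟨ cong (n ∸_) (countFin≡∣tabulate∣ (isUniversal G)) ⟨
  n ∸ numUniversal G                       ∎
  where open ≡-Reasoning

avoids : Graph n → Fin n → Subset n → Bool
avoids G v S = does (S ⊆? ∁ (closedNeighbourhood G v))

nonDominating⇒avoids-nonUniversal : ∀ (G : Graph n) i {S} → T (not (dominates G S) ∧ (∣ S ∣ ≡ᵇ suc i)) →
  Any (λ v → T (avoids G v S ∧ (∣ S ∣ ≡ᵇ suc i))) (nonUniversal G)
nonDominating⇒avoids-nonUniversal G i {S} h with Equivalence.to T-∧ h
... | ¬dom , size with ¬dominating⇒⊆∁closedNeighbourhood G (Equivalence.to (T-does (¬? (dominating? G S))) ¬dom)
... | v , S⊆∁N = lose (∈-filter⁺ (λ v → T? (not (isUniversal G v))) (∈-allFin v) (Equivalence.from T-not-≡ ¬universal))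
                      (Equivalence.from T-∧ (Equivalence.from (T-does (S ⊆? _)) S⊆∁N , size))
  where
  ¬universal : isUniversal G v ≡ false
  ¬universal = nonempty-⊆∁closedNeighbourhood⇒¬universal G
    (∣p∣≡suc⇒nonempty S (≡ᵇ⇒≡ ∣ S ∣ (suc i) size)) S⊆∁N

module _ (G : Graph n) (δ : ℕ) (δ≤degree : ∀ v → isUniversal G v ≡ false → δ ≤ degree G v) where

  nonDominating-countOfSize-bound : ∀ i → n ≤ suc i + suc i →
    countOfSize (not ∘ dominates G) (suc i) * 2 ^ (δ + 1) ≤ (n ∸ numUniversal G) * (n C suc i)
  nonDominating-countOfSize-bound i n≤2i = begin
    countOfSize (not ∘ dominates G) (suc i) * 2 ^ (δ + 1)
      ≤⟨ *-monoˡ-≤ (2 ^ (δ + 1)) (count-union-bound (λ v S → avoids G v S ∧ (∣ S ∣ ≡ᵇ suc i))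
                                    (nonUniversal G) (allSubsets n) (λ S → nonDominating⇒avoids-nonUniversal G i)) ⟩
    sum (map (λ v → countOfSize (avoids G v) (suc i)) (nonUniversal G)) * 2 ^ (δ + 1)
      ≤⟨ sum-map-*-≤ _ (nonUniversal G)
                     (All.map avoiding-bound (all-filter (λ v → T? (not (isUniversal G v))) (allFin n))) ⟩
    length (nonUniversal G) * (n C suc i)
      ≡⟨ cong (_* (n C suc i)) (length-nonUniversal G) ⟩
    (n ∸ numUniversal G) * (n C suc i)
      ∎
    where
    open ≤-Reasoning
    avoiding-bound : ∀ {v} → T (not (isUniversal G v)) →
      countOfSize (avoids G v) (suc i) * 2 ^ (δ + 1) ≤ n C suc i
    avoiding-bound {v} ¬universal =
      ≤-trans (*-monoʳ-≤ (countOfSize (avoids G v) (suc i)) (^-monoʳ-≤ 2 δ+1≤∣N∣))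
              (countOfSize-⊆∁*2^∣R∣≤nCi (closedNeighbourhood G v) (suc i) n≤2i)
      where
      δ+1≤∣N∣ : δ + 1 ≤ ∣ closedNeighbourhood G v ∣
      δ+1≤∣N∣ = subst (_≤ ∣ closedNeighbourhood G v ∣) (+-comm 1 δ)
        (≤-trans (s≤s (δ≤degree v (Equivalence.to T-not-≡ ¬universal))) (degree<∣closedNeighbourhood∣ G v))

  module _ (few-universal : (n ∸ numUniversal G) * (n + 2) ≤ 2 ^ (δ + 1)) where

    nonDominating-countOfSize-small : ∀ i → n ≤ suc i + suc i → suc (suc i) ≤ n →
      suc (suc i) * countOfSize (not ∘ dominates G) (suc i) ≤ n C suc i
    nonDominating-countOfSize-small i n≤2i i<n = *-cancelʳ-≤ (suc (suc i) * N) c K {{m^n≢0 2 (δ + 1)}} (begin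
      suc (suc i) * N * K      ≡⟨ *-assoc (suc (suc i)) N K ⟩
      suc (suc i) * (N * K)    ≤⟨ *-mono-≤ (m≤n⇒m≤n+o 2 i<n) (nonDominating-countOfSize-bound i n≤2i) ⟩
      (n + 2) * ((n ∸ m) * c)  ≡⟨ *-assoc (n + 2) (n ∸ m) c ⟨
      (n + 2) * (n ∸ m) * c    ≡⟨ cong (_* c) (*-comm (n + 2) (n ∸ m)) ⟩
      (n ∸ m) * (n + 2) * c    ≤⟨ *-monoˡ-≤ c few-universal ⟩
      K * c                    ≡⟨ *-comm K c ⟩
      c * K                    ∎)
      where
      open ≤-Reasoning
      N = countOfSize (not ∘ dominates G) (suc i)
      c = n C suc i
      K = 2 ^ (δ + 1)
      m = numUniversal G

    dominating-decreasing : ∀ i → n ≤ i + i → suc i ≤ n → d G (suc i) ≤ d G i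
    dominating-decreasing zero      n≤0  1≤n = contradiction (≤-trans 1≤n n≤0) λ ()
    dominating-decreasing i@(suc j) n≤2i i<n = *-cancelˡ-≤ (suc i) (begin
      suc i * d G (suc i)   ≤⟨ *-monoʳ-≤ (suc i) D′≤c′ ⟩
      suc i * (n C suc i)   ≤⟨ n≤k+r⇒[1+k]*nC[1+k]≤r*nCk n≤2i ⟩
      i * c                 ≤⟨ i*c≤[1+i]*D ⟩
      suc i * d G i         ∎)
      where
      open ≤-Reasoning
      N = countOfSize (not ∘ dominates G) i
      c = n C i
      D+N≡c : ∀ i → d G i + countOfSize (not ∘ dominates G) i ≡ n C i
      D+N≡c i = trans (cong (_+ countOfSize (not ∘ dominates G) i) (d≡countOfSize G i))
                      (countOfSize-not (dominates G) i)
      D′≤c′ : d G (suc i) ≤ n C suc i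
      D′≤c′ = subst (d G (suc i) ≤_) (D+N≡c (suc i)) (m≤m+n _ _)
      i*c≤[1+i]*D : i * c ≤ suc i * d G i
      i*c≤[1+i]*D = +-cancelʳ-≤ (suc i * N) _ _ (begin
        i * c + suc i * N           ≤⟨ +-monoʳ-≤ (i * c) (nonDominating-countOfSize-small j n≤2i i<n) ⟩
        i * c + c                   ≡⟨ +-comm (i * c) c ⟩
        suc i * c                   ≡⟨ cong (suc i *_) (D+N≡c i) ⟨
        suc i * (d G i + N)         ≡⟨ *-distribˡ-+ (suc i) (d G i) N ⟩
        suc i * d G i + suc i * N   ∎)

⌈n/2⌉+⌈n/2⌉≤1+n : ∀ n → ⌈ n /2⌉ + ⌈ n /2⌉ ≤ suc n
⌈n/2⌉+⌈n/2⌉≤1+n zero          = z≤n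
⌈n/2⌉+⌈n/2⌉≤1+n (suc zero)    = ≤-refl
⌈n/2⌉+⌈n/2⌉≤1+n (suc (suc n)) =
  s≤s (subst (_≤ suc (suc n)) (sym (+-suc ⌈ n /2⌉ ⌈ n /2⌉)) (s≤s (⌈n/2⌉+⌈n/2⌉≤1+n n)))

i<⌈n/2⌉⇒i+i<n : ∀ n {i} → i < ⌈ n /2⌉ → i + i < n
i<⌈n/2⌉⇒i+i<n n {i} i<⌈n/2⌉ = ≤-pred (begin
  suc (suc (i + i))   ≡⟨ cong suc (+-suc i i) ⟨
  suc i + suc i       ≤⟨ +-mono-≤ i<⌈n/2⌉ i<⌈n/2⌉ ⟩
  ⌈ n /2⌉ + ⌈ n /2⌉   ≤⟨ ⌈n/2⌉+⌈n/2⌉≤1+n n ⟩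
  suc n               ∎)
  where open ≤-Reasoning

⌈n/2⌉≤i⇒n≤i+i : ∀ n {i} → ⌈ n /2⌉ ≤ i → n ≤ i + i
⌈n/2⌉≤i⇒n≤i+i n {i} ⌈n/2⌉≤i = begin
  n                   ≡⟨ ⌊n/2⌋+⌈n/2⌉≡n n ⟨
  ⌊ n /2⌋ + ⌈ n /2⌉   ≤⟨ +-monoˡ-≤ ⌈ n /2⌉ (⌊n/2⌋≤⌈n/2⌉ n) ⟩
  ⌈ n /2⌉ + ⌈ n /2⌉   ≤⟨ +-mono-≤ ⌈n/2⌉≤i ⌈n/2⌉≤i ⟩
  i + i               ∎
  where open ≤-Reasoning

corollary12 : (n : ℕ) → 6 ≤ n → (G : Graph n) → (δ : ℕ) →
    (∀ v → isUniversal G v ≡ false → δ ≤ degree G v) →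
    (n ∸ numUniversal G) * (n + 2) ≤ 2 ^ (δ + 1) →
    UnimodalWithMode n (d G) ⌈ n /2⌉
corollary12 n _ G δ δ≤degree few-universal = increasing , decreasing
  where
  increasing : ∀ i → i + 1 ≤ ⌈ n /2⌉ → d G i ≤ d G (i + 1)
  increasing i i<⌈n/2⌉ rewrite +-comm i 1 = dominating-increasing G i (i<⌈n/2⌉⇒i+i<n n i<⌈n/2⌉)
  decreasing : ∀ i → ⌈ n /2⌉ ≤ i → i + 1 ≤ n → d G (i + 1) ≤ d G i
  decreasing i ⌈n/2⌉≤i i<n rewrite +-comm i 1 =
    dominating-decreasing G δ δ≤degree few-universal i (⌈n/2⌉≤i⇒n≤i+i n ⌈n/2⌉≤i) i<n
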